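{- Let $n\ge 2$, let $G$ be a group of order $v$ whose elements are listed as $g_1,\ldots,g_v$, let $D\subseteq G$ be a $(v,k,\lambda)$ difference set in $G$, and let $C(i_1,\ldots,i_n)=[g_{i_1}\cdots g_{i_n}\in D]$ be the associated difference cube. Then the autotopy group $\mathrm{Atop}(C)$ contains a subgroup isomorphic to a semidirect product $(G^{n-1})\rtimes \mathrm{Mult}(D)$, where $G^{n-1}=G\times\cdots\times G$ ($n-1$ factors).
   Context: A $(v,k,\lambda)$ difference set in a group $G$ of order $v$ is a $k$-subset $D\subseteq G$ such that every non-identity $g\in G$ can be written as $d_1^{ -1}d_2$ with $d_1,d_2\in D$ in exactly $\lambda$ ways. $[P]$ is $1$ if $P$ holds and $0$ otherwise. An $n$-cube of order $v$ is a function $C:\{1,\ldots,v\}^n\to\{0,1\}$. The group $(S_v)^n$ acts on $n$-cubes by $C^\alpha(i_1,\ldots,i_n)=C(\alpha_1^{ -1}(i_1),\ldots,\alpha_n^{ -1}(i_n))$ for $\alpha=(\alpha_1,\ldots,\alpha_n)$; the autotopy group $\mathrm{Atop}(C)$ is the stabiliser of $C$ under this action. A multiplier of $D$ is a group automorphism $\varphi$ of $G$ such that $\varphi(D)=aD$ for some $a\in G$; the multipliers form a subgroup $\mathrm{Mult}(D)\le\mathrm{Aut}(G)$. -}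

module Defs where

open import Data.Nat using (ℕ; zero; suc)
open import Data.Fin using (Fin; zero; suc; _≟_)
open import Data.Fin.Subset using (Subset; _∈_; ∣_∣)
open import Data.Fin.Subset.Properties using (_∈?_)
open import Data.Fin.Permutation using (Permutation′; _⟨$⟩ʳ_; _⟨$⟩ˡ_)
open import Data.Bool using (Bool)
open import Data.List using (length; filter; cartesianProduct; allFin)
open import Data.Product using (∃; _×_; _,_; proj₁; proj₂)
open import Relation.Nullary using (¬_; does; Dec)
open import Relation.Nullary.Decidable using (_×-dec_)
open import Relation.Binary.PropositionalEquality using (_≡_)
open import Algebra.Core using (Op₁; Op₂)
open import Algebra.Structures using (IsGroup)
open import Function.Bundles using (_⇔_)

-- A group of order v whose elements are listed as g_0,…,g_{v-1}:
-- we identify g_i with i : Fin v, so the carrier is Fin v itself.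
record FinGroup (v : ℕ) : Set where
  infixl 7 _∙_
  infix 8 _⁻¹
  field
    _∙_ : Op₂ (Fin v)
    ε : Fin v
    _⁻¹ : Op₁ (Fin v)
    isGroup : IsGroup _≡_ _∙_ ε _⁻¹

Cube : ℕ → ℕ → Set
Cube n v = (Fin n → Fin v) → Bool

PermTuple : ℕ → ℕ → Set
PermTuple n v = Fin n → Permutation′ v

act : ∀ {n v} → PermTuple n v → Cube n v → Cube n v
act α C i = C (λ j → α j ⟨$⟩ˡ i j)

IsAutotopy : ∀ {n v} → Cube n v → PermTuple n v → Set
IsAutotopy C α = ∀ i → act α C i ≡ C i

_≈ₚ_ : ∀ {n v} → PermTuple n v → PermTuple n v → Set
α ≈ₚ β = ∀ j t → α j ⟨$⟩ʳ t ≡ β j ⟨$⟩ʳ t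

IsPermProduct : ∀ {n v} → PermTuple n v → PermTuple n v → PermTuple n v → Set
IsPermProduct α β γ = ∀ j t → γ j ⟨$⟩ʳ t ≡ α j ⟨$⟩ʳ (β j ⟨$⟩ʳ t)

module _ {v : ℕ} (G : FinGroup v) where
  open FinGroup G

  prod : ∀ {n} → (Fin n → Fin v) → Fin v
  prod {zero} _ = ε
  prod {suc n} f = f zero ∙ prod (λ j → f (suc j))

  diffCount : Subset v → Fin v → ℕ
  diffCount D g =
    length (filter (λ p → (proj₁ p ∈? D) ×-dec (proj₂ p ∈? D) ×-dec ((proj₁ p ⁻¹ ∙ proj₂ p) ≟ g))
                   (cartesianProduct (allFin v) (allFin v)))

  record IsDifferenceSet (k lam : ℕ) (D : Subset v) : Set where
    field
      size : ∣ D ∣ ≡ k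
      diff : ∀ g → ¬ (g ≡ ε) → diffCount D g ≡ lam

  diffCube : (n : ℕ) → Subset v → Cube n v
  diffCube n D i = does (prod i ∈? D)

  record IsAutomorphism (f : Fin v → Fin v) : Set where
    field
      inv : Fin v → Fin v
      inv-left : ∀ x → inv (f x) ≡ x
      inv-right : ∀ x → f (inv x) ≡ x
      hom : ∀ x y → f (x ∙ y) ≡ f x ∙ f y

  InImage : (Fin v → Fin v) → Subset v → Fin v → Set
  InImage f D x = ∃ λ d → d ∈ D × f d ≡ x

  InTranslate : Fin v → Subset v → Fin v → Set
  InTranslate a D x = ∃ λ d → d ∈ D × a ∙ d ≡ x

  record Multiplier (D : Subset v) : Set where
    field
      fun : Fin v → Fin v
      isAut : IsAutomorphism fun
      shift : Fin v
      maps : ∀ x → InImage fun D x ⇔ InTranslate shift D x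
  open Multiplier

  SemiDirect : ℕ → Subset v → Set
  SemiDirect m D = (Fin m → Fin v) × Multiplier D

  _≈sd_ : ∀ {m D} → SemiDirect m D → SemiDirect m D → Set
  (h , φ) ≈sd (h′ , φ′) = (∀ j → h j ≡ h′ j) × (∀ x → fun φ x ≡ fun φ′ x)

  IsSDProduct : ∀ {m D} → SemiDirect m D → SemiDirect m D → SemiDirect m D → Set
  IsSDProduct (h , φ) (h′ , φ′) (h″ , φ″) =
    (∀ j → h″ j ≡ h j ∙ fun φ (h′ j)) × (∀ x → fun φ″ x ≡ fun φ (fun φ′ x))

  -- an injective group homomorphism G^m ⋊ Mult(D) → (S_v)^n with image in Atop(C);
  -- its image is a subgroup of Atop(C) isomorphic to G^m ⋊ Mult(D)
  record EmbedsInAtop (m n : ℕ) (D : Subset v) (C : Cube n v) : Set where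
    field
      ρ : SemiDirect m D → PermTuple n v
      autotopy : ∀ x → IsAutotopy C (ρ x)
      cong : ∀ x y → x ≈sd y → ρ x ≈ₚ ρ y
      homo : ∀ x y z → IsSDProduct x y z → IsPermProduct (ρ x) (ρ y) (ρ z)
      injective : ∀ x y → ρ x ≈ₚ ρ y → x ≈sd y

-- With φ(D) = aD, the multiplier φ and h ∈ G^{n-1} act on the n coordinates by
-- x ↦ wⱼ φ(x) wⱼ₊₁⁻¹, where w = (a⁻¹, h₁, …, h_{n-1}, 1). In a product of coordinates
-- the inner wⱼ telescope, so g_{i_1}⋯g_{i_n} becomes a⁻¹ φ(g_{i_1}⋯g_{i_n}), and a⁻¹φ maps
-- D onto D: the tuple is an autotopy. This gives a faithful action of G^{n-1} ⋊ Mult(D)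
-- as soon as a is a function of φ obeying a(φφ′) = φ(a(φ′)) a(φ). If D = ∅ or D = G,
-- a = 1 will do. Otherwise D has trivial left stabiliser, so aD determines a, and the
-- cocycle law follows from φφ′(D) = φ(a(φ′)) a(φ) D.
-- For the stabiliser let Δˡ(g), Δʳ(g) count the pairs in D² with d₁⁻¹d₂ = g, resp.
-- d₁d₂⁻¹ = g. Both Σ Δˡ² and Σ Δʳ² count the same quadruples in D⁴, and Δˡ is constant
-- off 1, whence Σ Δʳ Δˡ = Σ Δˡ², so Σ (Δʳ − Δˡ)² = 0. If sD ⊆ D with s ≠ 1, then
-- λ = Δˡ(s) = Δʳ(s) = |D|, and Σ Δˡ = |D|² becomes v|D| = |D|²: D is ∅ or G.

module Submission where

open import Defs
open import Data.Nat using (ℕ; _≤_; _∸_)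
open import Data.Fin.Subset using (Subset)

open import Level using (0ℓ)
open import Data.Nat using (zero; suc; _+_; _*_; z≤n; ∣_-_∣)
open import Data.Nat.Properties
  using ( +-*-semiring; +-comm; *-comm; *-assoc; +-identityʳ; *-identityʳ; *-zeroʳ
        ; +-cancelˡ-≡; +-cancelʳ-≡; *-cancelʳ-≡; m*n≡0⇒m≡0∨n≡0
        ; ≤-refl; ≤-reflexive; ≤-trans; ≤-antisym; ≤-total; m≤m+n; m≤n⇒∃[o]m+o≡n
        ; +-mono-≤; +-monoʳ-≤; +-cancelʳ-≤; ∣m-m+n∣≡n; ∣-∣-comm; ∣m-n∣≡0⇒m≡n)
open import Data.Fin using (Fin; zero; suc; inject₁; fromℕ; punchIn; _≟_)
open import Data.Fin.Properties using (punchInᵢ≢i; all?)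
open import Data.Fin.Subset using (_∈_; _∉_)
open import Data.Fin.Subset.Properties using (_∈?_)
open import Data.Fin.Permutation as Perm using (Permutation′; permutation; _⟨$⟩ʳ_; _⟨$⟩ˡ_)
open import Data.Bool using (if_then_else_)
open import Data.Product using (_,_; _×_; proj₁; proj₂)
open import Data.Sum using (_⊎_; inj₁; inj₂; reduce) renaming (map to map-⊎)
open import Data.List using (length; filter; tabulate; cartesianProduct; map; _++_)
open import Data.List.Properties using (filter-++; length-++; map-tabulate)
open import Function using (_∘_; id; _⇔_; Equivalence; mk⇔)
open import Relation.Nullary using (Dec; yes; no; does; ¬_; ¬?; contradiction)
open import Relation.Unary using (Decidable)
open import Relation.Nullary.Decidable using (_×-dec_; _⊎-dec_; does-⇔; decidable-stable)
open import Relation.Binary.PropositionalEquality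
open import Algebra.Bundles using (Group)
open import Algebra.Structures using (IsGroup)
open import Algebra.Properties.Semiring.Sum +-*-semiring
  using (sum-syntax; sum-cong-≗; sum-remove; ∑-comm; ∑-permute; ∑-distrib-+; *-distribˡ-sum; *-distribʳ-sum)
open import Data.Nat.Solver using (module +-*-Solver)
open +-*-Solver using (solve; _:+_; _:*_; _:=_; con)

𝟙 : ∀ {p} {P : Set p} → Dec P → ℕ
𝟙 P? = if does P? then 1 else 0

𝟙-× : ∀ {p q} {P : Set p} {Q : Set q} (P? : Dec P) (Q? : Dec Q) → 𝟙 (P? ×-dec Q?) ≡ 𝟙 P? * 𝟙 Q?
𝟙-× (yes _) Q? = sym (+-identityʳ (𝟙 Q?))
𝟙-× (no _) Q? = refl

𝟙-⇔ : ∀ {p q} {P : Set p} {Q : Set q} → P ⇔ Q → (P? : Dec P) (Q? : Dec Q) → 𝟙 P? ≡ 𝟙 Q?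
𝟙-⇔ P⇔Q P? Q? = cong (λ b → if b then 1 else 0) (does-⇔ P⇔Q P? Q?)

𝟙-idem : ∀ {p} {P : Set p} (P? : Dec P) → 𝟙 P? * 𝟙 P? ≡ 𝟙 P?
𝟙-idem (yes _) = refl
𝟙-idem (no _) = refl

𝟙≤1 : ∀ {p} {P : Set p} (P? : Dec P) → 𝟙 P? ≤ 1
𝟙≤1 (yes _) = ≤-refl
𝟙≤1 (no _) = z≤n

𝟙-yes : ∀ {p} {P : Set p} (P? : Dec P) → P → 𝟙 P? ≡ 1
𝟙-yes (yes _) _ = refl
𝟙-yes (no ¬p) p = contradiction p ¬p

𝟙-no : ∀ {p} {P : Set p} (P? : Dec P) → ¬ P → 𝟙 P? ≡ 0
𝟙-no (yes p) ¬p = contradiction p ¬p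
𝟙-no (no _) _ = refl

𝟙≡1⇒ : ∀ {p} {P : Set p} (P? : Dec P) → 𝟙 P? ≡ 1 → P
𝟙≡1⇒ (yes p) _ = p

𝟙≡0⇒¬ : ∀ {p} {P : Set p} (P? : Dec P) → 𝟙 P? ≡ 0 → ¬ P
𝟙≡0⇒¬ (no ¬p) _ = ¬p

length-filter-tabulate : ∀ {a p} {A : Set a} {P : A → Set p} (P? : Decidable P) {n} (f : Fin n → A) →
  length (filter P? (tabulate f)) ≡ ∑[ i < n ] 𝟙 (P? (f i))
length-filter-tabulate P? {zero} f = refl
length-filter-tabulate P? {suc n} f with P? (f zero)
... | yes _ = cong suc (length-filter-tabulate P? (f ∘ suc))
... | no _ = length-filter-tabulate P? (f ∘ suc)

length-filter-cartesianProduct : ∀ {a b p} {A : Set a} {B : Set b} {P : A × B → Set p} (P? : Decidable P)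
  {m n} (f : Fin m → A) (g : Fin n → B) →
  length (filter P? (cartesianProduct (tabulate f) (tabulate g))) ≡ ∑[ i < m ] ∑[ j < n ] 𝟙 (P? (f i , g j))
length-filter-cartesianProduct P? {zero} f g = refl
length-filter-cartesianProduct P? {suc m} {n} f g = begin
  length (filter P? (row ++ rest))
    ≡⟨ cong length (filter-++ P? row rest) ⟩
  length (filter P? row ++ filter P? rest)
    ≡⟨ length-++ (filter P? row) ⟩
  length (filter P? row) + length (filter P? rest)
    ≡⟨ cong₂ _+_ (trans (cong (length ∘ filter P?) (map-tabulate g (f zero ,_))) (length-filter-tabulate P? (λ j → f zero , g j)))
                 (length-filter-cartesianProduct P? (f ∘ suc) g) ⟩
  ∑[ j < n ] 𝟙 (P? (f zero , g j)) + ∑[ i < m ] ∑[ j < n ] 𝟙 (P? (f (suc i) , g j)) ∎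
  where
  open ≡-Reasoning
  row = map (f zero ,_) (tabulate g)
  rest = cartesianProduct (tabulate (f ∘ suc)) (tabulate g)

∑-const : ∀ n c → ∑[ i < n ] c ≡ n * c
∑-const zero c = refl
∑-const (suc n) c = cong (c +_) (∑-const n c)

∑-mono-≤ : ∀ {n} {f g : Fin n → ℕ} → (∀ i → f i ≤ g i) → ∑[ i < n ] f i ≤ ∑[ i < n ] g i
∑-mono-≤ {zero} _ = z≤n
∑-mono-≤ {suc n} f≤g = +-mono-≤ (f≤g zero) (∑-mono-≤ (f≤g ∘ suc))

∑-≤-≡⇒≗ : ∀ {n} {f g : Fin n → ℕ} → (∀ i → f i ≤ g i) → ∑[ i < n ] f i ≡ ∑[ i < n ] g i → ∀ i → f i ≡ g i
∑-≤-≡⇒≗ {suc n} {f} {g} f≤g ∑f≡∑g = λ where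
    zero → f₀≡g₀
    (suc i) → ∑-≤-≡⇒≗ (f≤g ∘ suc) (+-cancelˡ-≡ (f zero) _ _ (trans ∑f≡∑g (cong (_+ _) (sym f₀≡g₀)))) i
  where
  f₀≡g₀ : f zero ≡ g zero
  f₀≡g₀ = ≤-antisym (f≤g zero) (+-cancelʳ-≤ _ (g zero) (f zero)
    (≤-trans (+-monoʳ-≤ (g zero) (∑-mono-≤ (f≤g ∘ suc))) (≤-reflexive (sym ∑f≡∑g))))

∑-punctured : ∀ {n} (f g : Fin n → ℕ) c μ → (∀ i → i ≢ c → g i ≡ μ) →
  ∑[ i < n ] (f i * g i) + f c * μ ≡ (∑[ i < n ] f i) * μ + f c * g c
∑-punctured {suc n} f g c μ g≡μ = begin
  ∑[ i < suc n ] (f i * g i) + f c * μ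
    ≡⟨ cong (_+ f c * μ) (sum-remove {i = c} (λ i → f i * g i)) ⟩
  f c * g c + ∑[ j < n ] (f (punchIn c j) * g (punchIn c j)) + f c * μ
    ≡⟨ cong (λ s → f c * g c + s + f c * μ) (sum-cong-≗ λ j → cong (f (punchIn c j) *_) (g≡μ _ (punchInᵢ≢i c j))) ⟩
  f c * g c + ∑[ j < n ] (f (punchIn c j) * μ) + f c * μ
    ≡⟨ swap-outer (f c * g c) _ (f c * μ) ⟩
  f c * μ + ∑[ j < n ] (f (punchIn c j) * μ) + f c * g c
    ≡⟨ cong (_+ f c * g c) (sum-remove {i = c} (λ i → f i * μ)) ⟨
  ∑[ i < suc n ] (f i * μ) + f c * g c
    ≡⟨ cong (_+ f c * g c) (*-distribʳ-sum μ f) ⟨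
  (∑[ i < suc n ] f i) * μ + f c * g c ∎
  where
  open ≡-Reasoning
  swap-outer : ∀ a b c → a + b + c ≡ c + b + a
  swap-outer = solve 3 (λ a b c → a :+ b :+ c := c :+ b :+ a) refl

∑-δ : ∀ {n} (f : Fin n → ℕ) c → ∑[ i < n ] (f i * 𝟙 (i ≟ c)) ≡ f c
∑-δ {n} f c = begin
  ∑[ i < n ] (f i * 𝟙 (i ≟ c))
    ≡⟨ +-identityʳ _ ⟨
  ∑[ i < n ] (f i * 𝟙 (i ≟ c)) + 0
    ≡⟨ cong (∑[ i < n ] (f i * 𝟙 (i ≟ c)) +_) (*-zeroʳ (f c)) ⟨
  ∑[ i < n ] (f i * 𝟙 (i ≟ c)) + f c * 0
    ≡⟨ ∑-punctured f (λ i → 𝟙 (i ≟ c)) c 0 (λ i → 𝟙-no (i ≟ c)) ⟩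
  (∑[ i < n ] f i) * 0 + f c * 𝟙 (c ≟ c)
    ≡⟨ cong₂ _+_ (*-zeroʳ (∑[ i < n ] f i)) (cong (f c *_) (𝟙-yes (c ≟ c) refl)) ⟩
  f c * 1
    ≡⟨ *-identityʳ (f c) ⟩
  f c ∎
  where open ≡-Reasoning

∑-*-∑ : ∀ {m n} (f : Fin m → ℕ) (g : Fin n → ℕ) → (∑[ i < m ] f i) * (∑[ j < n ] g j) ≡ ∑[ i < m ] ∑[ j < n ] (f i * g j)
∑-*-∑ f g = trans (*-distribʳ-sum _ f) (sum-cong-≗ λ i → *-distribˡ-sum (f i) g)

private
  square-gap-≤ : ∀ {m n} → m ≤ n → m * m + n * n ≡ 2 * (m * n) + ∣ m - n ∣ * ∣ m - n ∣
  square-gap-≤ {m} m≤n with d , refl ← m≤n⇒∃[o]m+o≡n m≤n rewrite ∣m-m+n∣≡n m d =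
    solve 2 (λ m d → m :* m :+ (m :+ d) :* (m :+ d) := con 2 :* (m :* (m :+ d)) :+ d :* d) refl m d

square-gap : ∀ m n → m * m + n * n ≡ 2 * (m * n) + ∣ m - n ∣ * ∣ m - n ∣
square-gap m n with ≤-total m n
... | inj₁ m≤n = square-gap-≤ m≤n
... | inj₂ n≤m = begin
  m * m + n * n                             ≡⟨ +-comm (m * m) (n * n) ⟩
  n * n + m * m                             ≡⟨ square-gap-≤ n≤m ⟩
  2 * (n * m) + ∣ n - m ∣ * ∣ n - m ∣       ≡⟨ cong₂ (λ a b → 2 * a + b * b) (*-comm n m) (∣-∣-comm n m) ⟩
  2 * (m * n) + ∣ m - n ∣ * ∣ m - n ∣       ∎
  where open ≡-Reasoning

2mn≤m²+n² : ∀ m n → 2 * (m * n) ≤ m * m + n * n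
2mn≤m²+n² m n = ≤-trans (m≤m+n _ _) (≤-reflexive (sym (square-gap m n)))

2mn≡m²+n²⇒m≡n : ∀ m n → 2 * (m * n) ≡ m * m + n * n → m ≡ n
2mn≡m²+n²⇒m≡n m n eq = ∣m-n∣≡0⇒m≡n (reduce (m*n≡0⇒m≡0∨n≡0 ∣ m - n ∣ gap≡0))
  where
  gap≡0 : ∣ m - n ∣ * ∣ m - n ∣ ≡ 0
  gap≡0 = +-cancelˡ-≡ (2 * (m * n)) _ 0 (trans (sym (square-gap m n)) (trans (sym eq) (sym (+-identityʳ _))))

m*n≡n*n⇒n≡0⊎m≡n : ∀ m n → m * n ≡ n * n → n ≡ 0 ⊎ m ≡ n
m*n≡n*n⇒n≡0⊎m≡n m zero _ = inj₁ refl
m*n≡n*n⇒n≡0⊎m≡n m (suc n) eq = inj₂ (*-cancelʳ-≡ m (suc n) (suc n) eq)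

Trivial : ∀ {v} → Subset v → Set
Trivial D = (∀ x → x ∉ D) ⊎ (∀ x → x ∈ D)

module FinGroupProperties {v : ℕ} (G : FinGroup v) where
  open FinGroup G public
  open IsGroup isGroup public using (assoc; identityˡ; identityʳ; inverseˡ)

  group : Group 0ℓ 0ℓ
  group = record { isGroup = isGroup }

  open import Algebra.Properties.Group group public
    using ( \\-leftDividesˡ; \\-leftDividesʳ; //-rightDividesˡ; //-rightDividesʳ
          ; ∙-cancelˡ; ∙-cancelʳ; inverseˡ-unique; identityʳ-unique; ε⁻¹≈ε; ⁻¹-anti-homo-∙)
  open import Algebra.Morphism.Definitions (Fin v) (Fin v) _≡_ public using (Homomorphic₂)

  prod-cong : ∀ {n} {f g : Fin n → Fin v} → (∀ j → f j ≡ g j) → prod G f ≡ prod G g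
  prod-cong {zero} _ = refl
  prod-cong {suc n} f≗g = cong₂ _∙_ (f≗g zero) (prod-cong (f≗g ∘ suc))

  x∙[x⁻¹∙y∙z]∙z⁻¹≡y : ∀ x y z → x ∙ (x ⁻¹ ∙ y ∙ z) ∙ z ⁻¹ ≡ y
  x∙[x⁻¹∙y∙z]∙z⁻¹≡y x y z =
    trans (cong (_∙ z ⁻¹) (sym (assoc x _ z))) (trans (//-rightDividesʳ z _) (\\-leftDividesˡ x y))

  x⁻¹∙[x∙y∙z⁻¹]∙z≡y : ∀ x y z → x ⁻¹ ∙ (x ∙ y ∙ z ⁻¹) ∙ z ≡ y
  x⁻¹∙[x∙y∙z⁻¹]∙z≡y x y z =
    trans (cong (_∙ z) (sym (assoc (x ⁻¹) _ _))) (trans (//-rightDividesˡ z _) (\\-leftDividesʳ x y))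

  ∑-∙ˡ : ∀ (f : Fin v → ℕ) x → ∑[ t < v ] f (x ∙ t) ≡ ∑[ t < v ] f t
  ∑-∙ˡ f x = sym (∑-permute f (permutation (x ∙_) (x ⁻¹ ∙_) (\\-leftDividesˡ x) (\\-leftDividesʳ x)))

  ∑-∙ʳ : ∀ (f : Fin v → ℕ) x → ∑[ t < v ] f (t ∙ x) ≡ ∑[ t < v ] f t
  ∑-∙ʳ f x = sym (∑-permute f (permutation (_∙ x) (_∙ x ⁻¹) (//-rightDividesˡ x) (//-rightDividesʳ x)))

  module Endomorphism {f : Fin v → Fin v} (hom : Homomorphic₂ f _∙_ _∙_) where

    ε-homo : f ε ≡ ε
    ε-homo = identityʳ-unique (f ε) (f ε) (trans (sym (hom ε ε)) (cong f (identityˡ ε)))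

    ⁻¹-homo : ∀ x → f (x ⁻¹) ≡ f x ⁻¹
    ⁻¹-homo x = inverseˡ-unique _ _ (trans (sym (hom (x ⁻¹) x)) (trans (cong f (inverseˡ x)) ε-homo))

    sandwich-∘ : ∀ l l′ r r′ y → l ∙ f (l′ ∙ y ∙ r′ ⁻¹) ∙ r ⁻¹ ≡ l ∙ f l′ ∙ f y ∙ (r ∙ f r′) ⁻¹
    sandwich-∘ l l′ r r′ y = begin
      l ∙ f (l′ ∙ y ∙ r′ ⁻¹) ∙ r ⁻¹
        ≡⟨ cong (λ z → l ∙ z ∙ r ⁻¹) (trans (hom _ _) (cong₂ _∙_ (hom l′ y) (⁻¹-homo r′))) ⟩
      l ∙ (f l′ ∙ f y ∙ f r′ ⁻¹) ∙ r ⁻¹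
        ≡⟨ cong (_∙ r ⁻¹) (sym (assoc l _ _)) ⟩
      l ∙ (f l′ ∙ f y) ∙ f r′ ⁻¹ ∙ r ⁻¹
        ≡⟨ cong (λ z → z ∙ f r′ ⁻¹ ∙ r ⁻¹) (sym (assoc l _ _)) ⟩
      l ∙ f l′ ∙ f y ∙ f r′ ⁻¹ ∙ r ⁻¹
        ≡⟨ assoc _ _ _ ⟩
      l ∙ f l′ ∙ f y ∙ (f r′ ⁻¹ ∙ r ⁻¹)
        ≡⟨ cong (l ∙ f l′ ∙ f y ∙_) (sym (⁻¹-anti-homo-∙ r (f r′))) ⟩
      l ∙ f l′ ∙ f y ∙ (r ∙ f r′) ⁻¹ ∎
      where open ≡-Reasoning

    telescope : ∀ {m} (w : Fin (suc (suc m)) → Fin v) (y : Fin (suc m) → Fin v) →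
      prod G (λ j → w (inject₁ j) ∙ f (y j) ∙ w (suc j) ⁻¹) ≡ w zero ∙ f (prod G y) ∙ w (fromℕ (suc m)) ⁻¹
    telescope {zero} w y = begin
      w zero ∙ f (y zero) ∙ w (suc zero) ⁻¹ ∙ ε
        ≡⟨ identityʳ _ ⟩
      w zero ∙ f (y zero) ∙ w (suc zero) ⁻¹
        ≡⟨ cong (λ z → w zero ∙ f z ∙ w (suc zero) ⁻¹) (sym (identityʳ (y zero))) ⟩
      w zero ∙ f (y zero ∙ ε) ∙ w (suc zero) ⁻¹ ∎
      where open ≡-Reasoning
    telescope {suc m} w y = begin
      a ∙ f (y zero) ∙ b ⁻¹ ∙ _
        ≡⟨ cong (a ∙ f (y zero) ∙ b ⁻¹ ∙_) (telescope (w ∘ suc) (y ∘ suc)) ⟩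
      a ∙ f (y zero) ∙ b ⁻¹ ∙ (b ∙ f p ∙ c ⁻¹)
        ≡⟨ assoc _ _ _ ⟨
      a ∙ f (y zero) ∙ b ⁻¹ ∙ (b ∙ f p) ∙ c ⁻¹
        ≡⟨ cong (_∙ c ⁻¹) (assoc _ _ _) ⟨
      a ∙ f (y zero) ∙ b ⁻¹ ∙ b ∙ f p ∙ c ⁻¹
        ≡⟨ cong (λ z → z ∙ f p ∙ c ⁻¹) (//-rightDividesˡ b _) ⟩
      a ∙ f (y zero) ∙ f p ∙ c ⁻¹
        ≡⟨ cong (_∙ c ⁻¹) (assoc _ _ _) ⟩
      a ∙ (f (y zero) ∙ f p) ∙ c ⁻¹
        ≡⟨ cong (λ z → a ∙ z ∙ c ⁻¹) (hom (y zero) p) ⟨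
      a ∙ f (y zero ∙ p) ∙ c ⁻¹ ∎
      where
      open ≡-Reasoning
      a = w zero
      b = w (suc zero)
      c = w (fromℕ (suc (suc m)))
      p = prod G (y ∘ suc)

  sandwich : ∀ {f : Fin v → Fin v} → IsAutomorphism G f → Fin v → Fin v → Permutation′ v
  sandwich {f} aut l r = permutation (λ x → l ∙ f x ∙ r ⁻¹) (λ y → inv (l ⁻¹ ∙ y ∙ r))
    (λ y → trans (cong (λ z → l ∙ z ∙ r ⁻¹) (inv-right _)) (x∙[x⁻¹∙y∙z]∙z⁻¹≡y l y r))
    (λ x → trans (cong inv (x⁻¹∙[x∙y∙z⁻¹]∙z≡y l (f x) r)) (inv-left x))
    where open IsAutomorphism aut

  frame : ∀ {m} → Fin v → (Fin m → Fin v) → Fin (suc (suc m)) → Fin v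
  frame a h zero = a
  frame {zero} a h (suc zero) = ε
  frame {suc m} a h (suc j) = frame (h zero) (h ∘ suc) j

  frame-last : ∀ {m} a (h : Fin m → Fin v) → frame a h (fromℕ (suc m)) ≡ ε
  frame-last {zero} a h = refl
  frame-last {suc m} a h = frame-last (h zero) (h ∘ suc)

  frame-inner : ∀ {m} a (h : Fin m → Fin v) j → frame a h (suc (inject₁ j)) ≡ h j
  frame-inner {suc m} a h zero = refl
  frame-inner {suc m} a h (suc j) = frame-inner (h zero) (h ∘ suc) j

  frame-cong : ∀ {m} {a a′} {h h′ : Fin m → Fin v} → a ≡ a′ → (∀ j → h j ≡ h′ j) →
    ∀ j → frame a h j ≡ frame a′ h′ j
  frame-cong a≡a′ h≗h′ zero = a≡a′
  frame-cong {zero} a≡a′ h≗h′ (suc zero) = refl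
  frame-cong {suc m} {h = h} {h′} a≡a′ h≗h′ (suc j) = frame-cong {h = h ∘ suc} {h′ ∘ suc} (h≗h′ zero) (h≗h′ ∘ suc) j

  frame-∙ : ∀ {m} {f : Fin v → Fin v} → f ε ≡ ε → ∀ {a a′ a″} {h h′ h″ : Fin m → Fin v} →
    a″ ≡ a ∙ f a′ → (∀ j → h″ j ≡ h j ∙ f (h′ j)) → ∀ j → frame a″ h″ j ≡ frame a h j ∙ f (frame a′ h′ j)
  frame-∙ fε≡ε a″≡ h″≡ zero = a″≡
  frame-∙ {zero} fε≡ε a″≡ h″≡ (suc zero) = sym (trans (cong (ε ∙_) fε≡ε) (identityˡ ε))
  frame-∙ {suc m} fε≡ε {h = h} {h′} {h″} a″≡ h″≡ (suc j) =
    frame-∙ fε≡ε {h = h ∘ suc} {h′ ∘ suc} {h″ ∘ suc} (h″≡ zero) (h″≡ ∘ suc) j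

  agree-from-last : ∀ {m} (u u′ : Fin (suc m) → Fin v) → u (fromℕ m) ≡ u′ (fromℕ m) →
    (∀ j → u (inject₁ j) ∙ u (suc j) ⁻¹ ≡ u′ (inject₁ j) ∙ u′ (suc j) ⁻¹) → ∀ j → u j ≡ u′ j
  agree-from-last {zero} u u′ last≡ quot≡ zero = last≡
  agree-from-last {suc m} u u′ last≡ quot≡ = λ where
      zero → ∙-cancelʳ _ _ _ (trans (quot≡ zero) (cong (λ z → u′ zero ∙ z ⁻¹) (sym (tail≡ zero))))
      (suc j) → tail≡ j
    where
    tail≡ = agree-from-last (u ∘ suc) (u′ ∘ suc) last≡ (quot≡ ∘ suc)

module DifferenceCounts {v : ℕ} (G : FinGroup v) (D : Subset v) where
  open FinGroupProperties G

  χ : Fin v → ℕ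
  χ x = 𝟙 (x ∈? D)

  κ : ℕ
  κ = ∑[ x < v ] χ x

  Δˡ Δʳ : Fin v → ℕ
  Δˡ g = ∑[ x < v ] (χ x * χ (x ∙ g))
  Δʳ g = ∑[ y < v ] (χ (g ∙ y) * χ y)

  diffCount≡Δˡ : ∀ g → diffCount G D g ≡ Δˡ g
  diffCount≡Δˡ g = trans (length-filter-cartesianProduct pair? id id) (sum-cong-≗ λ x → begin
    ∑[ y < v ] 𝟙 (pair? (x , y))                 ≡⟨ sum-cong-≗ (λ y → factor x y) ⟩
    ∑[ y < v ] (χ x * (χ y * 𝟙 (y ≟ x ∙ g)))     ≡⟨ *-distribˡ-sum (χ x) (λ y → χ y * 𝟙 (y ≟ x ∙ g)) ⟨
    χ x * ∑[ y < v ] (χ y * 𝟙 (y ≟ x ∙ g))       ≡⟨ cong (χ x *_) (∑-δ χ (x ∙ g)) ⟩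
    χ x * χ (x ∙ g)                                ∎)
    where
    open ≡-Reasoning
    pair? = λ p → proj₁ p ∈? D ×-dec proj₂ p ∈? D ×-dec proj₁ p ⁻¹ ∙ proj₂ p ≟ g
    factor : ∀ x y → 𝟙 (pair? (x , y)) ≡ χ x * (χ y * 𝟙 (y ≟ x ∙ g))
    factor x y = trans (𝟙-× (x ∈? D) (y ∈? D ×-dec x ⁻¹ ∙ y ≟ g))
      (cong (χ x *_) (trans (𝟙-× (y ∈? D) (x ⁻¹ ∙ y ≟ g)) (cong (χ y *_) (𝟙-⇔ x⁻¹∙y≡g⇔y≡x∙g (x ⁻¹ ∙ y ≟ g) (y ≟ x ∙ g)))))
      where
      x⁻¹∙y≡g⇔y≡x∙g : x ⁻¹ ∙ y ≡ g ⇔ y ≡ x ∙ g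
      x⁻¹∙y≡g⇔y≡x∙g = mk⇔ (λ e → trans (sym (\\-leftDividesˡ x y)) (cong (x ∙_) e))
                          (λ e → trans (cong (x ⁻¹ ∙_) e) (\\-leftDividesʳ x g))

  Δˡ-ε : Δˡ ε ≡ κ
  Δˡ-ε = sum-cong-≗ λ x → trans (cong (λ z → χ x * χ z) (identityʳ x)) (𝟙-idem (x ∈? D))

  Δʳ-stable : ∀ {s} → (∀ d → d ∈ D → s ∙ d ∈ D) → Δʳ s ≡ κ
  Δʳ-stable {s} sD⊆D = sum-cong-≗ stable
    where
    stable : ∀ y → χ (s ∙ y) * χ y ≡ χ y
    stable y with y ∈? D
    ... | yes y∈D = trans (*-identityʳ (χ (s ∙ y))) (𝟙-yes (s ∙ y ∈? D) (sD⊆D y y∈D))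
    ... | no _ = *-zeroʳ (χ (s ∙ y))

  Δʳ-ε : Δʳ ε ≡ κ
  Δʳ-ε = Δʳ-stable λ d d∈D → subst (_∈ D) (sym (identityˡ d)) d∈D

  ∑Δˡ : ∑[ g < v ] Δˡ g ≡ κ * κ
  ∑Δˡ = begin
    ∑[ g < v ] ∑[ x < v ] (χ x * χ (x ∙ g))   ≡⟨ ∑-comm (λ g x → χ x * χ (x ∙ g)) ⟩
    ∑[ x < v ] ∑[ g < v ] (χ x * χ (x ∙ g))   ≡⟨ sum-cong-≗ (λ x → *-distribˡ-sum (χ x) (λ g → χ (x ∙ g))) ⟨
    ∑[ x < v ] (χ x * ∑[ g < v ] χ (x ∙ g))   ≡⟨ sum-cong-≗ (λ x → cong (χ x *_) (∑-∙ˡ χ x)) ⟩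
    ∑[ x < v ] (χ x * κ)                       ≡⟨ *-distribʳ-sum κ χ ⟨
    κ * κ                                      ∎
    where open ≡-Reasoning

  ∑Δʳ : ∑[ g < v ] Δʳ g ≡ κ * κ
  ∑Δʳ = begin
    ∑[ g < v ] ∑[ y < v ] (χ (g ∙ y) * χ y)   ≡⟨ ∑-comm (λ g y → χ (g ∙ y) * χ y) ⟩
    ∑[ y < v ] ∑[ g < v ] (χ (g ∙ y) * χ y)   ≡⟨ sum-cong-≗ (λ y → *-distribʳ-sum (χ y) (λ g → χ (g ∙ y))) ⟨
    ∑[ y < v ] (∑[ g < v ] χ (g ∙ y) * χ y)   ≡⟨ sum-cong-≗ (λ y → cong (_* χ y) (∑-∙ʳ χ y)) ⟩
    ∑[ y < v ] (κ * χ y)                       ≡⟨ *-distribˡ-sum κ χ ⟨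
    κ * κ                                      ∎
    where open ≡-Reasoning

  T : Fin v → Fin v → Fin v → ℕ
  T y u z = χ y * χ z * χ u * χ (u ∙ (y ⁻¹ ∙ z))

  ∑Δˡ² : ∑[ g < v ] (Δˡ g * Δˡ g) ≡ ∑[ y < v ] ∑[ u < v ] ∑[ z < v ] T y u z
  ∑Δˡ² = begin
    ∑[ g < v ] (Δˡ g * Δˡ g)
      ≡⟨ sum-cong-≗ (λ g → ∑-*-∑ (λ x → χ x * χ (x ∙ g)) (λ w → χ w * χ (w ∙ g))) ⟩
    ∑[ g < v ] ∑[ x < v ] ∑[ w < v ] Q x w g
      ≡⟨ ∑-comm (λ g x → ∑[ w < v ] Q x w g) ⟩
    ∑[ x < v ] ∑[ g < v ] ∑[ w < v ] Q x w g
      ≡⟨ sum-cong-≗ (λ x → ∑-comm (λ g w → Q x w g)) ⟩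
    ∑[ x < v ] ∑[ w < v ] ∑[ g < v ] Q x w g
      ≡⟨ sum-cong-≗ (λ x → sum-cong-≗ (λ w → ∑-∙ˡ (Q x w) (x ⁻¹))) ⟨
    ∑[ x < v ] ∑[ w < v ] ∑[ z < v ] Q x w (x ⁻¹ ∙ z)
      ≡⟨ sum-cong-≗ (λ x → sum-cong-≗ (λ w → sum-cong-≗ (λ z → Q≡T x w z))) ⟩
    ∑[ x < v ] ∑[ w < v ] ∑[ z < v ] T x w z ∎
    where
    open ≡-Reasoning
    Q : Fin v → Fin v → Fin v → ℕ
    Q x w g = χ x * χ (x ∙ g) * (χ w * χ (w ∙ g))
    Q≡T : ∀ x w z → Q x w (x ⁻¹ ∙ z) ≡ T x w z
    Q≡T x w z = trans (cong (λ a → χ x * χ a * (χ w * χ (w ∙ (x ⁻¹ ∙ z)))) (\\-leftDividesˡ x z))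
                      (sym (*-assoc (χ x * χ z) (χ w) _))

  ∑Δʳ² : ∑[ g < v ] (Δʳ g * Δʳ g) ≡ ∑[ y < v ] ∑[ z < v ] ∑[ u < v ] T y u z
  ∑Δʳ² = begin
    ∑[ g < v ] (Δʳ g * Δʳ g)
      ≡⟨ sum-cong-≗ (λ g → ∑-*-∑ (λ y → χ (g ∙ y) * χ y) (λ z → χ (g ∙ z) * χ z)) ⟩
    ∑[ g < v ] ∑[ y < v ] ∑[ z < v ] Q y z g
      ≡⟨ ∑-comm (λ g y → ∑[ z < v ] Q y z g) ⟩
    ∑[ y < v ] ∑[ g < v ] ∑[ z < v ] Q y z g
      ≡⟨ sum-cong-≗ (λ y → ∑-comm (λ g z → Q y z g)) ⟩
    ∑[ y < v ] ∑[ z < v ] ∑[ g < v ] Q y z g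
      ≡⟨ sum-cong-≗ (λ y → sum-cong-≗ (λ z → ∑-∙ʳ (Q y z) (y ⁻¹))) ⟨
    ∑[ y < v ] ∑[ z < v ] ∑[ u < v ] Q y z (u ∙ y ⁻¹)
      ≡⟨ sum-cong-≗ (λ y → sum-cong-≗ (λ z → sum-cong-≗ (λ u → Q≡T y z u))) ⟩
    ∑[ y < v ] ∑[ z < v ] ∑[ u < v ] T y u z ∎
    where
    open ≡-Reasoning
    Q : Fin v → Fin v → Fin v → ℕ
    Q y z g = χ (g ∙ y) * χ y * (χ (g ∙ z) * χ z)
    Q≡T : ∀ y z u → Q y z (u ∙ y ⁻¹) ≡ T y u z
    Q≡T y z u = trans (cong₂ (λ a b → χ a * χ y * (χ b * χ z)) (//-rightDividesˡ y u) (assoc u (y ⁻¹) z))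
                      (reorder (χ u) (χ y) (χ (u ∙ (y ⁻¹ ∙ z))) (χ z))
      where
      reorder : ∀ a b c d → a * b * (c * d) ≡ b * d * a * c
      reorder = solve 4 (λ a b c d → a :* b :* (c :* d) := b :* d :* a :* c) refl

  ∑Δˡ²≡∑Δʳ² : ∑[ g < v ] (Δˡ g * Δˡ g) ≡ ∑[ g < v ] (Δʳ g * Δʳ g)
  ∑Δˡ²≡∑Δʳ² = trans ∑Δˡ² (trans (sum-cong-≗ (λ y → ∑-comm (T y))) (sym ∑Δʳ²))

  module _ {lam : ℕ} (Δˡ-const : ∀ g → g ≢ ε → Δˡ g ≡ lam) where

    ∑Δʳ*Δˡ≡∑Δˡ² : ∑[ g < v ] (Δʳ g * Δˡ g) ≡ ∑[ g < v ] (Δˡ g * Δˡ g)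
    ∑Δʳ*Δˡ≡∑Δˡ² = +-cancelʳ-≡ (κ * lam) _ _ (trans (against-Δˡ Δʳ Δʳ-ε ∑Δʳ) (sym (against-Δˡ Δˡ Δˡ-ε ∑Δˡ)))
      where
      against-Δˡ : ∀ f → f ε ≡ κ → ∑[ g < v ] f g ≡ κ * κ → ∑[ g < v ] (f g * Δˡ g) + κ * lam ≡ κ * κ * lam + κ * κ
      against-Δˡ f fε≡κ ∑f≡κ² = begin
        ∑[ g < v ] (f g * Δˡ g) + κ * lam     ≡⟨ cong (λ a → ∑[ g < v ] (f g * Δˡ g) + a * lam) fε≡κ ⟨
        ∑[ g < v ] (f g * Δˡ g) + f ε * lam   ≡⟨ ∑-punctured f Δˡ ε lam Δˡ-const ⟩
        (∑[ g < v ] f g) * lam + f ε * Δˡ ε   ≡⟨ cong₂ (λ a b → a * lam + b) ∑f≡κ² (cong₂ _*_ fε≡κ Δˡ-ε) ⟩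
        κ * κ * lam + κ * κ                   ∎
        where open ≡-Reasoning

    Δʳ≗Δˡ : ∀ g → Δʳ g ≡ Δˡ g
    Δʳ≗Δˡ g = 2mn≡m²+n²⇒m≡n (Δʳ g) (Δˡ g) (∑-≤-≡⇒≗ (λ t → 2mn≤m²+n² (Δʳ t) (Δˡ t)) ∑≡ g)
      where
      open ≡-Reasoning
      ∑≡ : ∑[ t < v ] (2 * (Δʳ t * Δˡ t)) ≡ ∑[ t < v ] (Δʳ t * Δʳ t + Δˡ t * Δˡ t)
      ∑≡ = begin
        ∑[ t < v ] (2 * (Δʳ t * Δˡ t))
          ≡⟨ *-distribˡ-sum 2 (λ t → Δʳ t * Δˡ t) ⟨
        2 * ∑[ t < v ] (Δʳ t * Δˡ t)
          ≡⟨ cong (2 *_) ∑Δʳ*Δˡ≡∑Δˡ² ⟩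
        2 * ∑[ t < v ] (Δˡ t * Δˡ t)
          ≡⟨ cong (∑[ t < v ] (Δˡ t * Δˡ t) +_) (+-identityʳ _) ⟩
        ∑[ t < v ] (Δˡ t * Δˡ t) + ∑[ t < v ] (Δˡ t * Δˡ t)
          ≡⟨ cong (_+ ∑[ t < v ] (Δˡ t * Δˡ t)) ∑Δˡ²≡∑Δʳ² ⟩
        ∑[ t < v ] (Δʳ t * Δʳ t) + ∑[ t < v ] (Δˡ t * Δˡ t)
          ≡⟨ ∑-distrib-+ (λ t → Δʳ t * Δʳ t) (λ t → Δˡ t * Δˡ t) ⟨
        ∑[ t < v ] (Δʳ t * Δʳ t + Δˡ t * Δˡ t) ∎

    stable⇒trivial : ∀ {s} → (∀ d → d ∈ D → s ∙ d ∈ D) → s ≢ ε → Trivial D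
    stable⇒trivial {s} sD⊆D s≢ε = map-⊎ empty full (m*n≡n*n⇒n≡0⊎m≡n v κ v*κ≡κ*κ)
      where
      κ≡lam : κ ≡ lam
      κ≡lam = trans (sym (Δʳ-stable sD⊆D)) (trans (Δʳ≗Δˡ s) (Δˡ-const s s≢ε))
      Δˡ≗κ : ∀ g → Δˡ g ≡ κ
      Δˡ≗κ g with g ≟ ε
      ... | yes refl = Δˡ-ε
      ... | no g≢ε = trans (Δˡ-const g g≢ε) (sym κ≡lam)
      v*κ≡κ*κ : v * κ ≡ κ * κ
      v*κ≡κ*κ = trans (sym (∑-const v κ)) (trans (sym (sum-cong-≗ Δˡ≗κ)) ∑Δˡ)
      empty : κ ≡ 0 → ∀ x → x ∉ D
      empty κ≡0 x = 𝟙≡0⇒¬ (x ∈? D) (sym (∑-≤-≡⇒≗ {f = λ _ → 0} (λ _ → z≤n) ∑0≡κ x))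
        where ∑0≡κ = trans (∑-const v 0) (trans (*-zeroʳ v) (sym κ≡0))
      full : v ≡ κ → ∀ x → x ∈ D
      full v≡κ x = 𝟙≡1⇒ (x ∈? D) (∑-≤-≡⇒≗ {g = λ _ → 1} (λ y → 𝟙≤1 (y ∈? D)) κ≡∑1 x)
        where κ≡∑1 = trans (sym v≡κ) (trans (sym (*-identityʳ v)) (sym (∑-const v 1)))

module _ {v : ℕ} (G : FinGroup v) (D : Subset v) where
  open FinGroupProperties G
  open Multiplier

  record Untwisting : Set where
    field
      untwist : Multiplier G D → Fin v
      untwist-preserves : ∀ φ x → x ∈ D ⇔ untwist φ ∙ fun φ x ∈ D
      untwist-cong : ∀ φ φ′ → (∀ x → fun φ x ≡ fun φ′ x) → untwist φ ≡ untwist φ′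
      untwist-∘ : ∀ φ φ′ φ″ → (∀ x → fun φ″ x ≡ fun φ (fun φ′ x)) →
        untwist φ″ ≡ untwist φ ∙ fun φ (untwist φ′)

  module _ (U : Untwisting) where
    open Untwisting U

    frameOf : ∀ {m} → SemiDirect G m D → Fin (suc (suc m)) → Fin v
    frameOf (h , φ) = frame (untwist φ) h

    ρ : ∀ {m} → SemiDirect G m D → PermTuple (suc m) v
    ρ x@(_ , φ) j = sandwich (isAut φ) (frameOf x (inject₁ j)) (frameOf x (suc j))

    ρ-ε : ∀ {m} (x : SemiDirect G m D) j → ρ x j ⟨$⟩ʳ ε ≡ frameOf x (inject₁ j) ∙ frameOf x (suc j) ⁻¹
    ρ-ε x@(_ , φ) j =
      trans (cong (λ z → l ∙ z ∙ r ⁻¹) (Endomorphism.ε-homo (IsAutomorphism.hom (isAut φ)))) (cong (_∙ r ⁻¹) (identityʳ l))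
      where l = frameOf x (inject₁ j)
            r = frameOf x (suc j)

    ρ-telescope : ∀ {m} (x : SemiDirect G m D) (y : Fin (suc m) → Fin v) →
      prod G (λ j → ρ x j ⟨$⟩ʳ y j) ≡ untwist (proj₂ x) ∙ fun (proj₂ x) (prod G y)
    ρ-telescope {m} x@(h , φ) y = begin
      prod G (λ j → ρ x j ⟨$⟩ʳ y j)
        ≡⟨ telescope (frameOf x) y ⟩
      untwist φ ∙ fun φ (prod G y) ∙ frameOf x (fromℕ (suc m)) ⁻¹
        ≡⟨ cong (λ z → _ ∙ z ⁻¹) (frame-last (untwist φ) h) ⟩
      untwist φ ∙ fun φ (prod G y) ∙ ε ⁻¹
        ≡⟨ cong (untwist φ ∙ fun φ (prod G y) ∙_) ε⁻¹≈ε ⟩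
      untwist φ ∙ fun φ (prod G y) ∙ ε
        ≡⟨ identityʳ _ ⟩
      untwist φ ∙ fun φ (prod G y) ∎
      where open ≡-Reasoning
            open Endomorphism (IsAutomorphism.hom (isAut φ))

    ρ-autotopy : ∀ {m} x → IsAutotopy (diffCube G (suc m) D) (ρ x)
    ρ-autotopy x@(_ , φ) i =
      does-⇔ (mk⇔ (subst (_∈ D) untwisted ∘ to) (from ∘ subst (_∈ D) (sym untwisted))) (prod G y ∈? D) (prod G i ∈? D)
      where
      y = λ j → ρ x j ⟨$⟩ˡ i j
      open Equivalence (untwist-preserves φ (prod G y))
      untwisted : untwist φ ∙ fun φ (prod G y) ≡ prod G i
      untwisted = trans (sym (ρ-telescope x y)) (prod-cong {g = i} (λ j → Perm.inverseʳ (ρ x j)))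

    ρ-cong : ∀ {m} (x y : SemiDirect G m D) → _≈sd_ G x y → ρ x ≈ₚ ρ y
    ρ-cong (h , φ) (h′ , φ′) (h≗h′ , φ≗φ′) j t =
      cong₂ _∙_ (cong₂ _∙_ (≗frame (inject₁ j)) (φ≗φ′ t)) (cong _⁻¹ (≗frame (suc j)))
      where ≗frame = frame-cong (untwist-cong φ φ′ φ≗φ′) h≗h′

    ρ-homo : ∀ {m} (x y z : SemiDirect G m D) → IsSDProduct G x y z → IsPermProduct (ρ x) (ρ y) (ρ z)
    ρ-homo x@(h , φ) y@(h′ , φ′) z@(h″ , φ″) (h″≡ , φ″≡) j t = begin
      frameOf z (inject₁ j) ∙ fun φ″ t ∙ frameOf z (suc j) ⁻¹
        ≡⟨ cong₂ _∙_ (cong₂ _∙_ (frame″≡ (inject₁ j)) (φ″≡ t)) (cong _⁻¹ (frame″≡ (suc j))) ⟩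
      l ∙ fun φ l′ ∙ fun φ (fun φ′ t) ∙ (r ∙ fun φ r′) ⁻¹
        ≡⟨ sandwich-∘ l l′ r r′ (fun φ′ t) ⟨
      l ∙ fun φ (l′ ∙ fun φ′ t ∙ r′ ⁻¹) ∙ r ⁻¹ ∎
      where
      open ≡-Reasoning
      open Endomorphism (IsAutomorphism.hom (isAut φ))
      frame″≡ = frame-∙ {f = fun φ} ε-homo {h = h} {h′} {h″} (untwist-∘ φ φ′ φ″ φ″≡) h″≡
      l = frameOf x (inject₁ j)
      r = frameOf x (suc j)
      l′ = frameOf y (inject₁ j)
      r′ = frameOf y (suc j)

    ρ-injective : ∀ {m} (x y : SemiDirect G m D) → ρ x ≈ₚ ρ y → _≈sd_ G x y
    ρ-injective x@(h , φ) y@(h′ , φ′) ρx≈ρy = h≗h′ , φ≗φ′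
      where
      frames≗ : ∀ j → frameOf x j ≡ frameOf y j
      frames≗ = agree-from-last (frameOf x) (frameOf y)
        (trans (frame-last (untwist φ) h) (sym (frame-last (untwist φ′) h′)))
        (λ j → trans (sym (ρ-ε x j)) (trans (ρx≈ρy j ε) (ρ-ε y j)))
      h≗h′ : ∀ j → h j ≡ h′ j
      h≗h′ j = trans (sym (frame-inner (untwist φ) h j))
                     (trans (frames≗ (suc (inject₁ j))) (frame-inner (untwist φ′) h′ j))
      φ≗φ′ : ∀ t → fun φ t ≡ fun φ′ t
      φ≗φ′ t = ∙-cancelˡ (frameOf x zero) _ _ (∙-cancelʳ (frameOf x (suc zero) ⁻¹) _ _
        (trans (ρx≈ρy zero t) (cong₂ (λ l r → l ∙ fun φ′ t ∙ r ⁻¹) (sym (frames≗ zero)) (sym (frames≗ (suc zero))))))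

    embedding : ∀ m → EmbedsInAtop G m (suc m) D (diffCube G (suc m) D)
    embedding m = record
      { ρ = ρ
      ; autotopy = ρ-autotopy
      ; cong = ρ-cong
      ; homo = ρ-homo
      ; injective = ρ-injective
      }

module _ {v : ℕ} {G : FinGroup v} {D : Subset v} where
  open FinGroupProperties G
  open Multiplier
  open Equivalence using (to; from)

  trivialUntwisting : Trivial D → Untwisting G D
  trivialUntwisting D-trivial = record
    { untwist = λ _ → ε
    ; untwist-preserves = λ _ _ → all-equivalent D-trivial
    ; untwist-cong = λ _ _ _ → refl
    ; untwist-∘ = λ φ _ _ _ → sym (trans (identityˡ _) (Endomorphism.ε-homo (IsAutomorphism.hom (isAut φ))))
    }
    where
    all-equivalent : ∀ {x y} → Trivial D → x ∈ D ⇔ y ∈ D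
    all-equivalent (inj₁ all∉) = mk⇔ (λ x∈D → contradiction x∈D (all∉ _)) (λ y∈D → contradiction y∈D (all∉ _))
    all-equivalent (inj₂ all∈) = mk⇔ (λ _ → all∈ _) (λ _ → all∈ _)

  shiftUntwisting : (∀ s → (∀ d → d ∈ D → s ∙ d ∈ D) → s ≡ ε) → Untwisting G D
  shiftUntwisting stabiliser-trivial = record
    { untwist = λ φ → shift φ ⁻¹
    ; untwist-preserves = preserves
    ; untwist-cong = λ φ φ′ φ≗φ′ → cong _⁻¹ (shift-cong φ φ′ φ≗φ′)
    ; untwist-∘ = untwist-∘
    }
    where
    translate-unique : ∀ {a b} → (∀ d → d ∈ D → InTranslate G b D (a ∙ d)) → a ≡ b
    translate-unique {a} {b} aD⊆bD = trans (sym (\\-leftDividesˡ b a)) (trans (cong (b ∙_) b⁻¹a≡ε) (identityʳ b))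
      where
      b⁻¹a≡ε : b ⁻¹ ∙ a ≡ ε
      b⁻¹a≡ε = stabiliser-trivial (b ⁻¹ ∙ a) λ d d∈D →
        let (d′ , d′∈D , bd′≡ad) = aD⊆bD d d∈D
        in subst (_∈ D) (trans (sym (\\-leftDividesʳ b d′)) (trans (cong (b ⁻¹ ∙_) bd′≡ad) (sym (assoc _ _ _)))) d′∈D

    image⊆translate : ∀ φ {d} → d ∈ D → InTranslate G (shift φ) D (fun φ d)
    image⊆translate φ d∈D = to (maps φ _) (_ , d∈D , refl)

    translate⊆image : ∀ φ {d} → d ∈ D → InImage G (fun φ) D (shift φ ∙ d)
    translate⊆image φ d∈D = from (maps φ _) (_ , d∈D , refl)

    preserves : ∀ φ x → x ∈ D ⇔ shift φ ⁻¹ ∙ fun φ x ∈ D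
    preserves φ x = mk⇔ to′ from′
      where
      to′ : x ∈ D → shift φ ⁻¹ ∙ fun φ x ∈ D
      to′ x∈D = let (d , d∈D , sd≡φx) = image⊆translate φ x∈D
                in subst (_∈ D) (trans (sym (\\-leftDividesʳ (shift φ) d)) (cong (shift φ ⁻¹ ∙_) sd≡φx)) d∈D
      from′ : shift φ ⁻¹ ∙ fun φ x ∈ D → x ∈ D
      from′ y∈D = let (d , d∈D , φd≡φx) = translate⊆image φ y∈D
                  in subst (_∈ D) (injective (trans φd≡φx (\\-leftDividesˡ (shift φ) (fun φ x)))) d∈D
        where
        open IsAutomorphism (isAut φ)
        injective : ∀ {y} → fun φ y ≡ fun φ x → y ≡ x
        injective {y} e = trans (sym (inv-left y)) (trans (cong inv e) (inv-left x))

    shift-cong : ∀ φ φ′ → (∀ x → fun φ x ≡ fun φ′ x) → shift φ ≡ shift φ′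
    shift-cong φ φ′ φ≗φ′ = translate-unique λ d d∈D →
      let (e , e∈D , φe≡sd) = translate⊆image φ d∈D
      in subst (InTranslate G (shift φ′) D) (trans (sym (φ≗φ′ e)) φe≡sd) (image⊆translate φ′ e∈D)

    shift-∘ : ∀ φ φ′ φ″ → (∀ x → fun φ″ x ≡ fun φ (fun φ′ x)) → shift φ″ ≡ fun φ (shift φ′) ∙ shift φ
    shift-∘ φ φ′ φ″ φ″≗φφ′ = translate-unique λ d d∈D →
      let (e , e∈D , φ″e≡s″d) = translate⊆image φ″ d∈D
          (e′ , e′∈D , s′e′≡φ′e) = image⊆translate φ′ e∈D
          (e″ , e″∈D , se″≡φe′) = image⊆translate φ e′∈D
      in e″ , e″∈D , (begin
        fun φ (shift φ′) ∙ shift φ ∙ e″     ≡⟨ assoc _ _ _ ⟩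
        fun φ (shift φ′) ∙ (shift φ ∙ e″)   ≡⟨ cong (fun φ (shift φ′) ∙_) se″≡φe′ ⟩
        fun φ (shift φ′) ∙ fun φ e′         ≡⟨ IsAutomorphism.hom (isAut φ) _ _ ⟨
        fun φ (shift φ′ ∙ e′)               ≡⟨ cong (fun φ) s′e′≡φ′e ⟩
        fun φ (fun φ′ e)                    ≡⟨ φ″≗φφ′ e ⟨
        fun φ″ e                            ≡⟨ φ″e≡s″d ⟩
        shift φ″ ∙ d                        ∎)
      where open ≡-Reasoning

    untwist-∘ : ∀ φ φ′ φ″ → (∀ x → fun φ″ x ≡ fun φ (fun φ′ x)) → shift φ″ ⁻¹ ≡ shift φ ⁻¹ ∙ fun φ (shift φ′ ⁻¹)
    untwist-∘ φ φ′ φ″ φ″≗φφ′ = begin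
      shift φ″ ⁻¹
        ≡⟨ cong _⁻¹ (shift-∘ φ φ′ φ″ φ″≗φφ′) ⟩
      (fun φ (shift φ′) ∙ shift φ) ⁻¹
        ≡⟨ ⁻¹-anti-homo-∙ _ _ ⟩
      shift φ ⁻¹ ∙ fun φ (shift φ′) ⁻¹
        ≡⟨ cong (shift φ ⁻¹ ∙_) (Endomorphism.⁻¹-homo (IsAutomorphism.hom (isAut φ)) _) ⟨
      shift φ ⁻¹ ∙ fun φ (shift φ′ ⁻¹) ∎
      where open ≡-Reasoning

trivial? : ∀ {v} (D : Subset v) → Dec (Trivial D)
trivial? D = all? (λ x → ¬? (x ∈? D)) ⊎-dec all? (_∈? D)

untwisting : ∀ {v} {G : FinGroup v} {k lam D} → IsDifferenceSet G k lam D → Untwisting G D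
untwisting {G = G} {lam = lam} {D = D} ds with trivial? D
... | yes D-trivial = trivialUntwisting D-trivial
... | no D-nontrivial = shiftUntwisting λ s sD⊆D →
  decidable-stable (s ≟ ε) (D-nontrivial ∘ stable⇒trivial Δˡ-const sD⊆D)
  where
  open FinGroup G using (ε)
  open DifferenceCounts G D
  Δˡ-const : ∀ g → g ≢ ε → Δˡ g ≡ lam
  Δˡ-const g g≢ε = trans (sym (diffCount≡Δˡ g)) (IsDifferenceSet.diff ds g g≢ε)

-- The construction needs only n ≥ 1; the omitted case n = 0 is refuted by 2 ≤ n.
theorem3p4 : ∀ {v : ℕ} (G : FinGroup v) (n k lam : ℕ) → 2 ≤ n →
    (D : Subset v) → IsDifferenceSet G k lam D →
    EmbedsInAtop G (n ∸ 1) n D (diffCube G n D)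
theorem3p4 G (suc n) k lam _ D ds = embedding G D (untwisting ds) n
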